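{- Let $\varphi\equiv\Pi:\Sigma$ and $\psi\equiv\Pi':\Sigma'$ be quantifier-free \textsf{SLAH} formulas with every free variable of $\psi$ free in $\varphi$. Then $\varphi\models\psi$ if and only if for every total preorder $\preceq$ over $\mathcal{A}(\varphi)\cup\mathcal{A}(\psi)$ that is compatible with $\varphi$, we have $\varphi\models_\preceq\psi$.
   Context: \textsf{SLAH}: variables range over $\mathbb{N}$; terms $t::=x\mid n\mid t+t$; pure formulas are conjunctions of $\top,\bot,t=t,t\ne t,t\le t,t<t$; spatial formulas are $\ast$-conjunctions of $\mathtt{emp}$, $t\mapsto t$, $\mathtt{blk}(t,t)$, $\mathtt{hls}(t,t;t^\infty)$ ($t^\infty$ a term or $\infty$). Semantics over stacks $s:\mathcal{V}\to\mathbb{N}$ and heaps $h:\mathbb{N}\rightharpoonup\mathbb{N}$: $t_1\mapsto t_2$ iff $\mathrm{dom}(h)=\{s(t_1)\}$, $h(s(t_1))=s(t_2)$; $\mathtt{blk}(t_1,t_2)$ iff $s(t_1)<s(t_2)$ and $\mathrm{dom}(h)=\{s(t_1),\dots,s(t_2)-1\}$; $\mathtt{emp}$ iff empty heap; $\ast$ is disjoint union of heaps; $\mathtt{hls}(t_1,t_2;t^\infty)$ iff $\mathtt{hls}^k$ for some $k$, with $\mathtt{hls}^0$: $s(t_1)=s(t_2)$ and empty heap, and $\mathtt{hls}^{\ell+1}(t_1,t_2;t^\infty)\equiv\exists z\cdot 2\le z-t_1\wedge\Pi'':t_1\mapsto z-t_1\ast\mathtt{blk}(t_1+1,z)\ast\mathtt{hls}^\ell(z,t_2;t^\infty)$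 where $\Pi''\equiv\top$ if $t^\infty=\infty$ and $\Pi''\equiv z-t_1\le t^\infty$ otherwise. $A\models B$ means every $(s,h)$ satisfying $A$ satisfies $B$. Start/end addresses: $\mathrm{head}(t_1\mapsto t_2)=t_1$, $\mathrm{tail}(t_1\mapsto t_2)=t_1+1$; for $a=\mathtt{blk}(t_1,t_2)$ or $\mathtt{hls}(t_1,t_2;t_3)$, $\mathrm{head}(a)=t_1$, $\mathrm{tail}(a)=t_2$. $\mathcal{A}(\varphi)$ is the set of terms $\mathrm{head}(a),\mathrm{tail}(a)$ for spatial atoms $a$ of $\varphi$. Presburger abstraction $\mathtt{Abs}(\Pi:\Sigma):=\Pi\wedge\phi_\Sigma\wedge\phi_\ast$, with $a_1,\dots,a_m$ the spatial atoms of $\Sigma$: $\phi_\Sigma=\bigwedge_i\mathtt{Abs}(a_i)$, $\mathtt{Abs}(t_1\mapsto t_2)=\top$, $\mathtt{Abs}(\mathtt{blk}(t_1,t_2))=t_1<t_2$, $\mathtt{Abs}(\mathtt{hls}(t_1,t_2;t_3))= t_1=t_2\vee(t_1<t_2\wedge A^+)$ with $A^+=(t_3=2\wedge t_1+2\le t_2\wedge t_1\equiv_2t_2)\vee(2<t_3\wedge t_1+2\le t_2)$ for a term $t_3$ and $A^+=t_1+2\le t_2$ if $t_3=\infty$; with $D_{ij}:=\mathrm{tail}(a_j)\le\mathrm{head}(a_i)\vee\mathrm{tail}(a_i)\le\mathrm{head}(a_j)$ and $N_i:=\mathrm{head}(a_i)<\mathrm{tail}(a_i)$, $\phi_\ast$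 conjoins over $i<j$: $(N_i\wedge N_j)\to D_{ij}$ if both are $\mathtt{hls}$ atoms, $N_k\to D_{ij}$ if exactly one ($a_k$) is, and $D_{ij}$ otherwise. For a total preorder $\preceq$ on a set $A$ of terms, write $t_1\simeq t_2$ if $t_1\preceq t_2$ and $t_2\preceq t_1$, and $t_1\prec t_2$ if $t_1\preceq t_2$ but not $t_2\preceq t_1$; let $C_\preceq:=\bigwedge_{t_1\simeq t_2}t_1=t_2\wedge\bigwedge_{t_1\prec t_2}t_1<t_2$ (over $t_1,t_2\in A$). A total preorder $\preceq$ on $\mathcal{A}(\varphi)\cup\mathcal{A}(\psi)$ is compatible with $\varphi$ if $C_\preceq\wedge\mathtt{Abs}(\varphi)$ is satisfiable over $\mathbb{N}$; for such $\preceq$, $\varphi\models_\preceq\psi$ means $C_\preceq\wedge\Pi:\Sigma\models\Pi':\Sigma'$. -}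

module Defs where

open import Data.Nat using (ℕ; zero; suc; _+_; _∸_; _≤_; _<_)
open import Data.Nat.DivMod using (_%_)
open import Data.Maybe using (Maybe; just; nothing)
open import Data.List using (List; []; _∷_; _++_; concatMap)
open import Data.List.Relation.Unary.All using (All)
open import Data.List.Relation.Unary.AllPairs using (AllPairs)
open import Data.List.Membership.Propositional using (_∈_)
open import Data.Product using (_×_; ∃; ∃₂)
open import Data.Sum using (_⊎_)
open import Data.Empty using (⊥)
open import Data.Unit using (⊤)
open import Relation.Nullary using (¬_)
open import Relation.Binary.PropositionalEquality using (_≡_; _≢_)

Var : Set
Var = ℕ

data Term : Set where
  var : Var → Term
  num : ℕ → Term
  _⊕_ : Term → Term → Term

data TermInf : Set where
  ∞   : TermInf
  fin : Term → TermInf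

data PureAtom : Set where
  ptop pbot : PureAtom
  _≐_ _≠ₜ_ _≤ₜ_ _<ₜ_ : Term → Term → PureAtom

data SpAtom : Set where
  emp : SpAtom
  _↦_ : Term → Term → SpAtom
  blk : Term → Term → SpAtom
  hls : Term → Term → TermInf → SpAtom

record Formula : Set where
  constructor _∶_
  field
    pure    : List PureAtom
    spatial : List SpAtom
open Formula public

Stack : Set
Stack = Var → ℕ

Heap : Set
Heap = ℕ → Maybe ℕ

⟦_⟧ : Term → Stack → ℕ
⟦ var x ⟧ s = s x
⟦ num n ⟧ s = n
⟦ t ⊕ u ⟧ s = ⟦ t ⟧ s + ⟦ u ⟧ s

⟦_⟧∞ : TermInf → Stack → Maybe ℕ
⟦ ∞ ⟧∞ s = nothing
⟦ fin t ⟧∞ s = just (⟦ t ⟧ s)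

Empty : Heap → Set
Empty h = ∀ x → h x ≡ nothing

InDom : Heap → ℕ → Set
InDom h x = ∃ λ v → h x ≡ just v

PointsTo : ℕ → ℕ → Heap → Set
PointsTo a v h = h a ≡ just v × (∀ x → x ≢ a → h x ≡ nothing)

Block : ℕ → ℕ → Heap → Set
Block a b h = a < b × (∀ x → a ≤ x → x < b → InDom h x)
                    × (∀ x → (x < a ⊎ b ≤ x) → h x ≡ nothing)

Split : Heap → Heap → Heap → Set
Split h h₁ h₂ = ∀ x → (h x ≡ h₁ x × h₂ x ≡ nothing) ⊎ (h x ≡ h₂ x × h₁ x ≡ nothing)

_⋆_ : (Heap → Set) → (Heap → Set) → Heap → Set
(P ⋆ Q) h = ∃₂ λ h₁ h₂ → Split h h₁ h₂ × P h₁ × Q h₂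

BoundOK : Maybe ℕ → ℕ → Set
BoundOK nothing  d = ⊤
BoundOK (just b) d = d ≤ b

HlsK : ℕ → ℕ → ℕ → Maybe ℕ → Heap → Set
HlsK zero    a b β h = a ≡ b × Empty h
HlsK (suc k) a b β h =
  ∃ λ z → a + 2 ≤ z × BoundOK β (z ∸ a)
        × (PointsTo a (z ∸ a) ⋆ (Block (a + 1) z ⋆ HlsK k z b β)) h

SatSp : Stack → SpAtom → Heap → Set
SatSp s emp         h = Empty h
SatSp s (t ↦ u)     h = PointsTo (⟦ t ⟧ s) (⟦ u ⟧ s) h
SatSp s (blk t u)   h = Block (⟦ t ⟧ s) (⟦ u ⟧ s) h
SatSp s (hls t u β) h = ∃ λ k → HlsK k (⟦ t ⟧ s) (⟦ u ⟧ s) (⟦ β ⟧∞ s) h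

SatSpL : Stack → List SpAtom → Heap → Set
SatSpL s []       h = Empty h
SatSpL s (a ∷ as) h = (SatSp s a ⋆ SatSpL s as) h

SatPure : Stack → PureAtom → Set
SatPure s ptop     = ⊤
SatPure s pbot     = ⊥
SatPure s (t ≐ u)  = ⟦ t ⟧ s ≡ ⟦ u ⟧ s
SatPure s (t ≠ₜ u) = ⟦ t ⟧ s ≢ ⟦ u ⟧ s
SatPure s (t ≤ₜ u) = ⟦ t ⟧ s ≤ ⟦ u ⟧ s
SatPure s (t <ₜ u) = ⟦ t ⟧ s < ⟦ u ⟧ s

SatPureL : Stack → List PureAtom → Set
SatPureL s Π = All (SatPure s) Π

_,_⊨_ : Stack → Heap → Formula → Set
s , h ⊨ φ = SatPureL s (pure φ) × SatSpL s (spatial φ) h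

_⊨_ : Formula → Formula → Set
φ ⊨ ψ = ∀ (s : Stack) (h : Heap) → s , h ⊨ φ → s , h ⊨ ψ

varsT : Term → List Var
varsT (var x) = x ∷ []
varsT (num n) = []
varsT (t ⊕ u) = varsT t ++ varsT u

varsTI : TermInf → List Var
varsTI ∞ = []
varsTI (fin t) = varsT t

varsP : PureAtom → List Var
varsP ptop = []
varsP pbot = []
varsP (t ≐ u)  = varsT t ++ varsT u
varsP (t ≠ₜ u) = varsT t ++ varsT u
varsP (t ≤ₜ u) = varsT t ++ varsT u
varsP (t <ₜ u) = varsT t ++ varsT u

varsS : SpAtom → List Var
varsS emp = []
varsS (t ↦ u) = varsT t ++ varsT u
varsS (blk t u) = varsT t ++ varsT u
varsS (hls t u β) = varsT t ++ varsT u ++ varsTI β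

fv : Formula → List Var
fv φ = concatMap varsP (pure φ) ++ concatMap varsS (spatial φ)

addrs : SpAtom → List Term
addrs emp         = []
addrs (t ↦ u)     = t ∷ (t ⊕ num 1) ∷ []
addrs (blk t u)   = t ∷ u ∷ []
addrs (hls t u β) = t ∷ u ∷ []

𝒜 : Formula → List Term
𝒜 φ = concatMap addrs (spatial φ)

-- head/tail (only used for non-emp atoms)
head tail : SpAtom → Term
head emp = num 0
head (t ↦ u) = t
head (blk t u) = t
head (hls t u β) = t
tail emp = num 0
tail (t ↦ u) = t ⊕ num 1
tail (blk t u) = u
tail (hls t u β) = u

-- Presburger abstraction Abs(Π : Σ), given by its meaning at a stack

AbsAtom : Stack → SpAtom → Set
AbsAtom s emp       = ⊤
AbsAtom s (t ↦ u)   = ⊤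
AbsAtom s (blk t u) = ⟦ t ⟧ s < ⟦ u ⟧ s
AbsAtom s (hls t u ∞) =
  ⟦ t ⟧ s ≡ ⟦ u ⟧ s ⊎ (⟦ t ⟧ s < ⟦ u ⟧ s × ⟦ t ⟧ s + 2 ≤ ⟦ u ⟧ s)
AbsAtom s (hls t u (fin c)) =
  ⟦ t ⟧ s ≡ ⟦ u ⟧ s
  ⊎ (⟦ t ⟧ s < ⟦ u ⟧ s
     × ((⟦ c ⟧ s ≡ 2 × ⟦ t ⟧ s + 2 ≤ ⟦ u ⟧ s × ⟦ t ⟧ s % 2 ≡ ⟦ u ⟧ s % 2)
        ⊎ (2 < ⟦ c ⟧ s × ⟦ t ⟧ s + 2 ≤ ⟦ u ⟧ s)))

NonEmptyA : Stack → SpAtom → Set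
NonEmptyA s a = ⟦ head a ⟧ s < ⟦ tail a ⟧ s

Disj : Stack → SpAtom → SpAtom → Set
Disj s a b = ⟦ tail b ⟧ s ≤ ⟦ head a ⟧ s ⊎ ⟦ tail a ⟧ s ≤ ⟦ head b ⟧ s

Guard : Stack → SpAtom → Set
Guard s (hls t u β) = NonEmptyA s (hls t u β)
Guard s _           = ⊤

PairCond : Stack → SpAtom → SpAtom → Set
PairCond s emp b = ⊤
PairCond s a emp = ⊤
PairCond s a b   = Guard s a → Guard s b → Disj s a b

Abs : Formula → Stack → Set
Abs φ s = SatPureL s (pure φ)
        × All (AbsAtom s) (spatial φ)
        × AllPairs (PairCond s) (spatial φ)

record TotalPreorderOn (A : List Term) (R : Term → Term → Set) : Set where
  field
    reflexive  : ∀ {t} → t ∈ A → R t t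
    transitive : ∀ {t u v} → t ∈ A → u ∈ A → v ∈ A → R t u → R u v → R t v
    total      : ∀ {t u} → t ∈ A → u ∈ A → R t u ⊎ R u t

C≼ : List Term → (Term → Term → Set) → Stack → Set
C≼ A R s = ∀ t u → t ∈ A → u ∈ A →
           (R t u → R u t → ⟦ t ⟧ s ≡ ⟦ u ⟧ s)
         × (R t u → ¬ R u t → ⟦ t ⟧ s < ⟦ u ⟧ s)

𝒜₂ : Formula → Formula → List Term
𝒜₂ φ ψ = 𝒜 φ ++ 𝒜 ψ

Compatible : (Term → Term → Set) → Formula → Formula → Set
Compatible R φ ψ = ∃ λ (s : Stack) → C≼ (𝒜₂ φ ψ) R s × Abs φ s

_⊨[_]_ : Formula → (Term → Term → Set) → Formula → Set
φ ⊨[ R ] ψ = ∀ (s : Stack) (h : Heap) → C≼ (𝒜₂ φ ψ) R s → s , h ⊨ φ → s , h ⊨ ψ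

{-# OPTIONS --safe #-}
module Submission where

-- Only the direction from ⊨_≼ to ⊨ has content. A model (s, h) of φ induces
-- the total preorder t ≼ u :⇔ s(t) ≤ s(u), which s satisfies as C_≼. This
-- preorder is compatible with φ because the Presburger abstraction is sound:
-- every model of Π : Σ satisfies Abs(Π : Σ) at its stack. Each atom contributes
-- its abstraction (hls chunks have size at least 2, bounded by t₃, hence of size
-- exactly 2 and parity-preserving when t₃ = 2), and atoms holding separated
-- subheaps occupy disjoint address intervals, which is φ_∗.

open import Defs
open import Data.List.Membership.Propositional using (_∈_)
open import Function.Bundles using (_⇔_; mk⇔)
open import Data.Nat using (ℕ; zero; suc; _+_; _∸_; _≤_; _<_; z≤n; s≤s; _⊔_; _≤?_; _<?_)
open import Data.Nat.Properties
open import Data.Nat.DivMod using (_%_; [m+n]%n≡m%n)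
open import Data.Maybe using (just)
open import Data.List using ([]; _∷_)
open import Data.List.Relation.Unary.All as All using (All; []; _∷_)
open import Data.List.Relation.Unary.AllPairs using (AllPairs; []; _∷_)
open import Data.Product using (_×_; _,_; proj₁; proj₂)
open import Data.Sum using (_⊎_; inj₁; inj₂)
open import Data.Empty using (⊥; ⊥-elim)
open import Data.Unit using (tt)
open import Relation.Nullary using (yes; no; contradiction)
open import Relation.Binary.PropositionalEquality

Disjoint : Heap → Heap → Set
Disjoint h₁ h₂ = ∀ x → InDom h₁ x → InDom h₂ x → ⊥

module _ {h h₁ h₂ : Heap} (split : Split h h₁ h₂) where

  split⇒disjoint : Disjoint h₁ h₂
  split⇒disjoint x (_ , h₁x) (_ , h₂x) with split x
  ... | inj₁ (_ , h₂x≡nothing) = contradiction (trans (sym h₂x) h₂x≡nothing) λ ()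
  ... | inj₂ (_ , h₁x≡nothing) = contradiction (trans (sym h₁x) h₁x≡nothing) λ ()

  split-domˡ : ∀ x → InDom h₁ x → InDom h x
  split-domˡ x (v , h₁x) with split x
  ... | inj₁ (hx≡h₁x , _)      = v , trans hx≡h₁x h₁x
  ... | inj₂ (_ , h₁x≡nothing) = contradiction (trans (sym h₁x) h₁x≡nothing) λ ()

  split-domʳ : ∀ x → InDom h₂ x → InDom h x
  split-domʳ x (v , h₂x) with split x
  ... | inj₂ (hx≡h₂x , _)      = v , trans hx≡h₂x h₂x
  ... | inj₁ (_ , h₂x≡nothing) = contradiction (trans (sym h₂x) h₂x≡nothing) λ ()

hls-≤ : ∀ {k a b β h} → HlsK k a b β h → a ≤ b
hls-≤ {zero}  (a≡b , _) = ≤-reflexive a≡b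
hls-≤ {suc k} {a} (z , a+2≤z , _ , _ , _ , _ , _ , _ , _ , _ , _ , rest) =
  ≤-trans (≤-trans (m≤m+n a 2) a+2≤z) (hls-≤ rest)

hls-+2≤ : ∀ {k a b β h} → HlsK (suc k) a b β h → a + 2 ≤ b
hls-+2≤ (_ , a+2≤z , _ , _ , _ , _ , _ , _ , _ , _ , _ , rest) = ≤-trans a+2≤z (hls-≤ rest)

hls-dom : ∀ {k a b β h} → HlsK k a b β h → ∀ x → a ≤ x → x < b → InDom h x
hls-dom {zero} (refl , _) x a≤x x<a = contradiction (≤-<-trans a≤x x<a) (<-irrefl refl)
hls-dom {suc k} {a} (z , _ , _ , _ , _ , split , (ha≡z∸a , _) , _ , _ , split′ , block , rest) x a≤x x<b
  with m≤n⇒m<n∨m≡n a≤x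
... | inj₂ refl = split-domˡ split x (_ , ha≡z∸a)
... | inj₁ a<x with x <? z
...   | yes x<z = split-domʳ split x (split-domˡ split′ x
                    (proj₁ (proj₂ block) x (subst (_≤ x) (+-comm 1 a) a<x) x<z))
...   | no  x≮z = split-domʳ split x (split-domʳ split′ x (hls-dom rest x (≮⇒≥ x≮z) x<b))

+2≤⇒2≤∸ : ∀ a z → a + 2 ≤ z → 2 ≤ z ∸ a
+2≤⇒2≤∸ a z a+2≤z = m+n≤o⇒m≤o∸n 2 (subst (_≤ z) (+-comm a 2) a+2≤z)

hls-bound-≥2 : ∀ {k a b c h} → HlsK (suc k) a b (just c) h → 2 ≤ c
hls-bound-≥2 {a = a} (z , a+2≤z , z∸a≤c , _) = ≤-trans (+2≤⇒2≤∸ a z a+2≤z) z∸a≤c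

-- With bound 2 every chunk has size exactly 2.
hls-parity : ∀ {k a b c h} → c ≡ 2 → HlsK k a b (just c) h → a % 2 ≡ b % 2
hls-parity {zero} _ (refl , _) = refl
hls-parity {suc k} {a} refl (z , a+2≤z , z∸a≤2 , _ , _ , _ , _ , _ , _ , _ , _ , rest) = begin
  a % 2       ≡⟨ [m+n]%n≡m%n a 2 ⟨
  (a + 2) % 2 ≡⟨ cong (_% 2) a+2≡z ⟩
  z % 2       ≡⟨ hls-parity refl rest ⟩
  _           ∎
  where
  open ≡-Reasoning
  a+2≡z : a + 2 ≡ z
  a+2≡z = begin
    a + 2       ≡⟨ cong (a +_) (≤-antisym (+2≤⇒2≤∸ a z a+2≤z) z∸a≤2) ⟩
    a + (z ∸ a) ≡⟨ m+[n∸m]≡n (≤-trans (m≤m+n a 2) a+2≤z) ⟩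
    z           ∎

+2≤⇒< : ∀ a {b} → a + 2 ≤ b → a < b
+2≤⇒< a a+2≤b = <-≤-trans (m<m+n a (s≤s z≤n)) a+2≤b

AbsAtom-sound : ∀ s a {h} → SatSp s a h → AbsAtom s a
AbsAtom-sound s emp         _                 = tt
AbsAtom-sound s (t ↦ u)     _                 = tt
AbsAtom-sound s (blk t u)   (t<u , _)         = t<u
AbsAtom-sound s (hls t u ∞) (zero , t≡u , _)  = inj₁ t≡u
AbsAtom-sound s (hls t u ∞) (suc k , H)       =
  inj₂ (+2≤⇒< (⟦ t ⟧ s) (hls-+2≤ H) , hls-+2≤ H)
AbsAtom-sound s (hls t u (fin c)) (zero , t≡u , _) = inj₁ t≡u
AbsAtom-sound s (hls t u (fin c)) (suc k , H)
  with m≤n⇒m<n∨m≡n (hls-bound-≥2 H)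
... | inj₁ 2<c = inj₂ (+2≤⇒< (⟦ t ⟧ s) (hls-+2≤ H) , inj₂ (2<c , hls-+2≤ H))
... | inj₂ 2≡c = inj₂ (+2≤⇒< (⟦ t ⟧ s) (hls-+2≤ H) ,
                       inj₁ (sym 2≡c , hls-+2≤ H , hls-parity {suc k} (sym 2≡c) H))

-- head and tail of emp are junk values, hence the hypothesis a ≢ emp.
Occupies : Stack → SpAtom → (ℕ → Set) → Set
Occupies s a D = a ≢ emp → Guard s a →
  NonEmptyA s a × (∀ x → ⟦ head a ⟧ s ≤ x → x < ⟦ tail a ⟧ s → D x)

Occupies-mono : ∀ {s a} {D E : ℕ → Set} → (∀ x → D x → E x) → Occupies s a D → Occupies s a E
Occupies-mono D⊆E occ a≢emp guard =
  proj₁ (occ a≢emp guard) , λ x l u → D⊆E x (proj₂ (occ a≢emp guard) x l u)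

SatSp⇒Occupies : ∀ s a {h} → SatSp s a h → Occupies s a (InDom h)
SatSp⇒Occupies s emp         _           emp≢emp _ = contradiction refl emp≢emp
SatSp⇒Occupies s (blk t u)   (t<u , dom , _) _ _   = t<u , dom
SatSp⇒Occupies s (hls t u β) (_ , H)     _ t<u     = t<u , hls-dom H
SatSp⇒Occupies s (t ↦ u) {h} (ht≡u , _)  _ _       =
  subst (⟦ t ⟧ s <_) (+-comm 1 (⟦ t ⟧ s)) (n<1+n _) , cell
  where
  cell : ∀ x → ⟦ t ⟧ s ≤ x → x < ⟦ t ⟧ s + 1 → InDom h x
  cell x t≤x x<t+1 = subst (InDom h) (≤-antisym t≤x (≤-pred (subst (suc x ≤_) (+-comm (⟦ t ⟧ s) 1) x<t+1)))
                           (_ , ht≡u)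

-- Two nonempty intervals that are not ordered share their larger left end.
occupies-disjoint⇒Disj : ∀ s a b {D E : ℕ → Set} → (∀ x → D x → E x → ⊥) →
  a ≢ emp → b ≢ emp → Occupies s a D → Occupies s b E → Guard s a → Guard s b → Disj s a b
occupies-disjoint⇒Disj s a b D∩E=∅ a≢emp b≢emp occA occB guardA guardB
  with occA a≢emp guardA | occB b≢emp guardB
     | ⟦ tail b ⟧ s ≤? ⟦ head a ⟧ s | ⟦ tail a ⟧ s ≤? ⟦ head b ⟧ s
... | _ | _ | yes tb≤ha | _ = inj₁ tb≤ha
... | _ | _ | no _ | yes ta≤hb = inj₂ ta≤hb
... | (ha<ta , inA) | (hb<tb , inB) | no tb≰ha | no ta≰hb =
  ⊥-elim (D∩E=∅ m (inA m (m≤m⊔n _ _) (⊔-lub ha<ta (≰⇒> ta≰hb)))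
                  (inB m (m≤n⊔m _ _) (⊔-lub (≰⇒> tb≰ha) hb<tb)))
  where m = ⟦ head a ⟧ s ⊔ ⟦ head b ⟧ s

PairCond-intro : ∀ s a b → (a ≢ emp → b ≢ emp → Guard s a → Guard s b → Disj s a b) → PairCond s a b
PairCond-intro s emp         _           _ = tt
PairCond-intro s (_ ↦ _)     emp         _ = tt
PairCond-intro s (blk _ _)   emp         _ = tt
PairCond-intro s (hls _ _ _) emp         _ = tt
PairCond-intro s (_ ↦ _)     (_ ↦ _)     d = d (λ ()) (λ ())
PairCond-intro s (_ ↦ _)     (blk _ _)   d = d (λ ()) (λ ())
PairCond-intro s (_ ↦ _)     (hls _ _ _) d = d (λ ()) (λ ())
PairCond-intro s (blk _ _)   (_ ↦ _)     d = d (λ ()) (λ ())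
PairCond-intro s (blk _ _)   (blk _ _)   d = d (λ ()) (λ ())
PairCond-intro s (blk _ _)   (hls _ _ _) d = d (λ ()) (λ ())
PairCond-intro s (hls _ _ _) (_ ↦ _)     d = d (λ ()) (λ ())
PairCond-intro s (hls _ _ _) (blk _ _)   d = d (λ ()) (λ ())
PairCond-intro s (hls _ _ _) (hls _ _ _) d = d (λ ()) (λ ())

SatSpL⇒Occupies : ∀ s as {h} → SatSpL s as h → All (λ b → Occupies s b (InDom h)) as
SatSpL⇒Occupies s []       _ = []
SatSpL⇒Occupies s (a ∷ as) (_ , _ , split , sat-a , sat-as) =
  Occupies-mono (split-domˡ split) (SatSp⇒Occupies s a sat-a)
  ∷ All.map (Occupies-mono (split-domʳ split)) (SatSpL⇒Occupies s as sat-as)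

SatSpL⇒AbsAtoms : ∀ s as {h} → SatSpL s as h → All (AbsAtom s) as
SatSpL⇒AbsAtoms s []       _ = []
SatSpL⇒AbsAtoms s (a ∷ as) (_ , _ , _ , sat-a , sat-as) =
  AbsAtom-sound s a sat-a ∷ SatSpL⇒AbsAtoms s as sat-as

SatSpL⇒PairConds : ∀ s as {h} → SatSpL s as h → AllPairs (PairCond s) as
SatSpL⇒PairConds s []       _ = []
SatSpL⇒PairConds s (a ∷ as) (_ , _ , split , sat-a , sat-as) =
  All.map (λ {b} occB → PairCond-intro s a b λ a≢emp b≢emp →
            occupies-disjoint⇒Disj s a b (split⇒disjoint split) a≢emp b≢emp
              (SatSp⇒Occupies s a sat-a) occB)
          (SatSpL⇒Occupies s as sat-as)
  ∷ SatSpL⇒PairConds s as sat-as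

Abs-sound : ∀ φ {s h} → _,_⊨_ s h φ → Abs φ s
Abs-sound φ {s} (sat-Π , sat-Σ) =
  sat-Π , SatSpL⇒AbsAtoms s (spatial φ) sat-Σ , SatSpL⇒PairConds s (spatial φ) sat-Σ

≤-at : Stack → Term → Term → Set
≤-at s t u = ⟦ t ⟧ s ≤ ⟦ u ⟧ s

≤-at-totalPreorder : ∀ s A → TotalPreorderOn A (≤-at s)
≤-at-totalPreorder s A = record
  { reflexive  = λ _ → ≤-refl
  ; transitive = λ _ _ _ → ≤-trans
  ; total      = λ {t} {u} _ _ → ≤-total (⟦ t ⟧ s) (⟦ u ⟧ s)
  }

C≼-≤-at : ∀ s A → C≼ A (≤-at s) s
C≼-≤-at s A _ _ _ _ = ≤-antisym , λ _ u≰t → ≰⇒> u≰t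

lemma2 : (φ ψ : Formula) →
           (∀ x → x ∈ fv ψ → x ∈ fv φ) →
           (φ ⊨ ψ) ⇔
           ((R : Term → Term → Set) → TotalPreorderOn (𝒜₂ φ ψ) R →
              Compatible R φ ψ → φ ⊨[ R ] ψ)
lemma2 φ ψ _ = mk⇔ (λ φ⊨ψ _ _ _ s h _ → φ⊨ψ s h) ⊨-under-induced-preorder
  where
  ⊨-under-induced-preorder : ((R : Term → Term → Set) → TotalPreorderOn (𝒜₂ φ ψ) R →
                               Compatible R φ ψ → φ ⊨[ R ] ψ) → φ ⊨ ψ
  ⊨-under-induced-preorder ⊨≼ s h sat =
    ⊨≼ (≤-at s) (≤-at-totalPreorder s A) (s , C≼-≤-at s A , Abs-sound φ sat) s h (C≼-≤-at s A) sat
    where A = 𝒜₂ φ ψ
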